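{- Let $k\ge1$ and $r\ge 0$ be integers, and let $(A,B)$ be a partition of the vertex set of $G_k$ into two sides. If the biadjacency matrix of this partition has rank at most $r$ (over $\mathbb{Z}_2$), then the partition has at most $4r+1$ blocks.
   Context: $G_k$ is the graph with vertices $v_0,v_1,\dots,v_{3^k-1}$ (in this linear order, the order along the boundary of its drawing) represented by the following confluent drawing; adjacency means existence of a smooth curve in the union of tracks between the two distinct vertices, passing only through tracks and junctions (junctions are points where $\ge 3$ tracks meet with a common tangent). Drawing: in the closed upper half-plane, place the vertices on the horizontal line left to right and join consecutive vertices $v_t,v_{t+1}$ by straight tracks along the line; odd-indexed vertices have no other tracks. The remaining tracks are in levels $0,\dots,k-1$ (bottom to top); the bottom line of level $i$ contains $\lceil 3^{k-i}/2\rceil$ points $p_{i,j}$ ($0\le j<3^{k-i}/2$), left to right, with $p_{0,j}=v_{2j}$ and $p_{i,j}$ junctions for $i\ge1$, where tracks enter the level vertically. In level $i$, consecutive $p_{i,j},p_{i,j+1}$ are joined by a semicircle, subdivided by two junctions into three arcs of angle $\pi/3$ when $j$ is a multiple of $3$ (except the single top-level semicircle joining $p_{k-1,0},p_{k-1,1}$, which is not subdivided), otherwise a single track. For $i<k-1$ and each subdivided semicircle joining $p_{i,j},p_{i,j+1}$, two congruent arcs run from the subdivision junctions up to $p_{i+1,j/3}$ (above the center, vertical tangent), the left one continuing smoothly the arc ending at $p_{i,j}$ and the right one continuing smoothly the arc ending at $p_{i,j+1}$. Biadjacency matrix of a partition $(A,B)$: the 0/1 matrix over $\mathbb{Z}_2$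 with rows indexed by $A$, columns by $B$, entry $1$ iff the two vertices are adjacent. A block of the partition is a maximal set of vertices that are consecutive in the order $v_0,\dots,v_{3^k-1}$ and all lie on the same side. -}

module Defs where

open import Data.Nat using (ℕ; zero; suc; _+_; _*_; _∸_; _^_; _<_; ⌈_/2⌉)
open import Data.Nat.DivMod using (_/_)
open import Data.Nat.Divisibility using (_∣_)
open import Data.Bool using (Bool; true; false; _∧_; _xor_; if_then_else_)
open import Data.Fin using (Fin; toℕ) renaming (zero to fzero; suc to fsuc)
open import Data.Product using (Σ; _×_; _,_)
open import Data.Sum using (_⊎_)
open import Relation.Nullary using (¬_)
open import Relation.Binary.PropositionalEquality using (_≡_; _≢_)
open import Function.Bundles using (_⇔_)
open import Data.Empty using (⊥)
open import Data.Unit using (⊤)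

-- Combinatorial encoding of the confluent drawing of G_k.
--
-- Nodes of the drawing: the vertices v_t, the level junctions p_{i,j}
-- (i ≥ 1), and the two subdivision junctions (left/right) of the
-- subdivided semicircle joining p_{i,j} and p_{i,j+1}.

data Node : Set where
  vtx : ℕ → Node
  pj  : ℕ → ℕ → Node
  lj  : ℕ → ℕ → Node
  rj  : ℕ → ℕ → Node

-- At a junction all incident tracks share a common tangent line; the
-- track-ends split into the two sides of that tangent.  A smooth curve
-- passing through a junction arrives on one side and leaves on the other.
-- (At vertices the side label is irrelevant.)
data Side : Set where
  s₀ s₁ : Side

End : Set
End = Node × Side

P : ℕ → ℕ → Node
P zero    j = vtx (2 * j)
P (suc i) j = pj (suc i) j

npts : ℕ → ℕ → ℕ
npts k i = ⌈ 3 ^ (k ∸ i) /2⌉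

below above : Side     -- at p_{i,j}: tracks coming from below / semicircles of level i
below = s₀
above = s₁
outer inner : Side     -- at subdivision junctions: the arc towards p_{i,j} (or p_{i,j+1})
outer = s₀             -- versus {middle arc, arc going up}
inner = s₁

Subdivided : ℕ → ℕ → ℕ → Set
Subdivided k i j = (suc i < k) × (3 ∣ j) × (suc j < npts k i)

data IsTrack (k : ℕ) : End → End → Set where
  line : ∀ {t} → suc t < 3 ^ k → IsTrack k (vtx t , s₀) (vtx (suc t) , s₀)
  semi : ∀ {i j} → i < k → suc j < npts k i → (¬ (3 ∣ j) ⊎ suc i ≡ k) →
         IsTrack k (P i j , above) (P i (suc j) , above)
  arcL : ∀ {i j} → Subdivided k i j → IsTrack k (P i j , above) (lj i j , outer)
  arcM : ∀ {i j} → Subdivided k i j → IsTrack k (lj i j , inner) (rj i j , inner)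
  arcR : ∀ {i j} → Subdivided k i j → IsTrack k (rj i j , outer) (P i (suc j) , above)
  upL  : ∀ {i j} → Subdivided k i j → IsTrack k (lj i j , inner) (P (suc i) (j / 3) , below)
  upR  : ∀ {i j} → Subdivided k i j → IsTrack k (rj i j , inner) (P (suc i) (j / 3) , below)

DTrack : ℕ → End → End → Set
DTrack k a b = IsTrack k a b ⊎ IsTrack k b a

IsJunction : Node → Set
IsJunction (vtx _) = ⊥
IsJunction _       = ⊤

-- SmoothWalk k u e : a smooth curve starting at vertex v_u, running
-- along tracks, passing (smoothly) only through junctions, and
-- currently arriving at end e.
data SmoothWalk (k : ℕ) (u : ℕ) : End → Set where
  start : ∀ {s b} → DTrack k (vtx u , s) b → SmoothWalk k u b
  step  : ∀ {n s s' b} → SmoothWalk k u (n , s) → IsJunction n →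
          s ≢ s' → DTrack k (n , s') b → SmoothWalk k u b

Adj : ℕ → ℕ → ℕ → Set
Adj k u w = u ≢ w × Σ Side (λ s → SmoothWalk k u (vtx w , s))

xorSum : (n : ℕ) → (Fin n → Bool) → Bool
xorSum zero    f = false
xorSum (suc n) f = f fzero xor xorSum n (λ l → f (fsuc l))

-- The partition (A,B) is given by side : Fin (3^k) → Bool,
-- A = side⁻¹(true) (rows), B = side⁻¹(false) (columns).
-- The biadjacency matrix has ℤ₂-rank ≤ r iff its row space is spanned
-- by r vectors w₀..w_{r-1} ∈ ℤ₂^B.
BiadjRankAtMost : (k : ℕ) → (Fin (3 ^ k) → Bool) → ℕ → Set
BiadjRankAtMost k side r =
  Σ (Fin r → Fin (3 ^ k) → Bool) λ w →
    (a : Fin (3 ^ k)) → side a ≡ true →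
    Σ (Fin r → Bool) λ c →
      (b : Fin (3 ^ k)) → side b ≡ false →
      (xorSum r (λ l → c l ∧ w l b) ≡ true) ⇔ Adj k (toℕ a) (toℕ b)

numBlocks : (n : ℕ) → (Fin n → Bool) → ℕ
numBlocks zero          f = 0
numBlocks (suc zero)    f = 1
numBlocks (suc (suc n)) f =
  (if f fzero xor f (fsuc fzero) then 1 else 0) + numBlocks (suc n) (λ i → f (fsuc i))

-- Consecutive vertices of G_k are adjacent, while a vertex of odd index is adjacent only
-- to its two neighbours on the line.  Every block boundary is a crossing t between v_t
-- and v_{t+1}; its endpoint in A and its endpoint in B give an entry 1 of the biadjacency
-- matrix.  Sort the crossings into four types by the side of v_t and the parity of t.  For
-- two crossings t, t′ of one type, the A-endpoint of t′ and the B-endpoint of t have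
-- different parities, so they can only be adjacent when t′ = t or t′ = t ± 2, the sign
-- being fixed by the type.  Listed in the right order, the crossings of one type thus form
-- a triangular submatrix with unit diagonal, which has at most r rows: Gaussian elimination
-- on a spanning family of r vectors uses up one vector per row.  So there are at most 4r
-- crossings and at most 4r + 1 blocks.

module Submission where

open import Defs
open import Algebra.Bundles using (CommutativeRing)
open import Data.Bool using (Bool; true; false; not; _∧_; _xor_; if_then_else_; _≟_)
open import Data.Bool.Properties
  using (xor-∧-commutativeRing; xor-comm; ∧-assoc; ∧-distribˡ-xor; ∧-identityʳ; ∧-conicalʳ; ¬-not)
open import Data.Empty using (⊥-elim)
open import Data.Fin using (Fin; toℕ; inject₁; punchIn) renaming (zero to fzero; suc to fsuc)
open import Data.Fin.Properties using (toℕ<n; toℕ-inject₁)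
open import Data.List using (List; []; _∷_; length; filter; map; reverse; allFin; tabulate)
open import Data.List.Properties using (length-map; length-reverse; map-tabulate; unfold-reverse)
open import Data.List.Relation.Unary.All as All using (All; []; _∷_)
open import Data.List.Relation.Unary.All.Properties as Allₚ using (all-filter)
open import Data.List.Relation.Unary.AllPairs using (AllPairs; []; _∷_)
open import Data.List.Relation.Unary.AllPairs.Properties as AllPairsₚ using (tabulate⁺-<)
open import Data.List.Relation.Unary.Any.Properties as Anyₚ using ()
open import Data.Nat using (ℕ; zero; suc; _+_; _*_; _^_; _≤_; _<_; z≤n; s≤s)
open import Data.Nat.Properties
  using (module ≤-Reasoning; +-suc; +-mono-≤; suc-injective; <-irrefl; <-asym; n<1+n; m<n⇒m<1+n; 1+n≢n)
open import Data.Nat.Solver using (module +-*-Solver)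
open import Data.Product using (Σ; ∃; _×_; _,_; proj₁; proj₂)
open import Data.Sum using (_⊎_; inj₁; inj₂) renaming (swap to ⊎-swap)
open import Function using (_∘_; _on_; flip; id)
open import Function.Bundles using (_⇔_; Equivalence)
open import Relation.Nullary using (¬_; does)
open import Relation.Unary using (Pred; Decidable)
open import Relation.Binary.PropositionalEquality
open import Algebra.Properties.Semiring.Sum (CommutativeRing.semiring xor-∧-commutativeRing)
  using (sum; sum-remove; ∑-distrib-+; *-distribʳ-sum; sum-cong-≗)

xorSum≡sum : ∀ n (f : Fin n → Bool) → xorSum n f ≡ sum f
xorSum≡sum zero    f = refl
xorSum≡sum (suc n) f = cong (f fzero xor_) (xorSum≡sum n (f ∘ fsuc))

xorSum≡true⇒∃ : ∀ n (f : Fin n → Bool) → xorSum n f ≡ true → ∃ λ i → f i ≡ true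
xorSum≡true⇒∃ (suc n) f eq with f fzero in f₀
... | true  = fzero , f₀
... | false = let i , fi = xorSum≡true⇒∃ n (f ∘ fsuc) eq in fsuc i , fi

xor≡false⇒≡ : ∀ x y → x xor y ≡ false → y ≡ x
xor≡false⇒≡ false false _ = refl
xor≡false⇒≡ true  true  _ = refl

xor≡true⇒≡not : ∀ x y → x xor y ≡ true → y ≡ not x
xor≡true⇒≡not false true  _ = refl
xor≡true⇒≡not true  false _ = refl

module _ {J : Set} where

  combination : ∀ {r} → (Fin r → Bool) → (Fin r → J → Bool) → J → Bool
  combination {r} c w b = xorSum r (λ l → c l ∧ w l b)

  -- Pivoting on generator p at column b₀: every vector of the span that vanishes at b₀ is
  -- a combination of the remaining generators, each corrected to vanish at b₀.
  eliminate : ∀ {r} → (Fin (suc r) → J → Bool) → Fin (suc r) → J → Fin r → J → Bool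
  eliminate w p b₀ l b = w (punchIn p l) b xor (w (punchIn p l) b₀ ∧ w p b)

  combination-eliminate : ∀ {r} (c : Fin (suc r) → Bool) w p b₀ → w p b₀ ≡ true → combination c w b₀ ≡ false →
    ∀ b → combination (c ∘ punchIn p) (eliminate w p b₀) b ≡ combination c w b
  combination-eliminate {r} c w p b₀ wpb₀ cwb₀ b = begin
    combination c′ (eliminate w p b₀) b
      ≡⟨ xorSum≡sum r (λ l → c′ l ∧ eliminate w p b₀ l b) ⟩
    sum (λ l → c′ l ∧ eliminate w p b₀ l b)
      ≡⟨ sum-cong-≗ {x = λ l → c′ l ∧ eliminate w p b₀ l b} distribute ⟩
    sum (λ l → kept l xor (eliminated l ∧ w p b))
      ≡⟨ ∑-distrib-+ kept (λ l → eliminated l ∧ w p b) ⟩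
    sum kept xor sum (λ l → eliminated l ∧ w p b)
      ≡⟨ cong (sum kept xor_) (*-distribʳ-sum (w p b) eliminated) ⟨
    sum kept xor (sum eliminated ∧ w p b)
      ≡⟨ cong (λ x → sum kept xor (x ∧ w p b)) eliminated≡cp ⟩
    sum kept xor (c p ∧ w p b)
      ≡⟨ xor-comm (sum kept) _ ⟩
    (c p ∧ w p b) xor sum kept
      ≡⟨ sum-remove (λ l → c l ∧ w l b) ⟨
    sum (λ l → c l ∧ w l b)
      ≡⟨ xorSum≡sum (suc r) (λ l → c l ∧ w l b) ⟨
    combination c w b ∎
    where
    open ≡-Reasoning
    c′ = c ∘ punchIn p
    kept eliminated : Fin r → Bool
    kept l = c′ l ∧ w (punchIn p l) b
    eliminated l = c′ l ∧ w (punchIn p l) b₀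
    distribute : ∀ l → c′ l ∧ eliminate w p b₀ l b ≡ kept l xor (eliminated l ∧ w p b)
    distribute l = trans (∧-distribˡ-xor (c′ l) _ _) (cong (kept l xor_) (sym (∧-assoc (c′ l) _ _)))
    eliminated≡cp : sum eliminated ≡ c p
    eliminated≡cp = xor≡false⇒≡ (c p) _ (begin
      c p xor sum eliminated             ≡⟨ cong (_xor sum eliminated) (∧-identityʳ (c p)) ⟨
      (c p ∧ true) xor sum eliminated    ≡⟨ cong (λ x → (c p ∧ x) xor sum eliminated) wpb₀ ⟨
      (c p ∧ w p b₀) xor sum eliminated  ≡⟨ sum-remove (λ l → c l ∧ w l b₀) ⟨
      sum (λ l → c l ∧ w l b₀)           ≡⟨ xorSum≡sum (suc r) (λ l → c l ∧ w l b₀) ⟨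
      combination c w b₀                 ≡⟨ cwb₀ ⟩
      false                              ∎)

module _ {I J : Set} (R : I → J → Set) (Col : J → Set) where

  InSpan : ∀ {r} → (Fin r → J → Bool) → I → Set
  InSpan {r} w a = Σ (Fin r → Bool) λ c → ∀ b → Col b → (combination c w b ≡ true) ⇔ R a b

  InSpan-eliminate : ∀ {r} {w : Fin (suc r) → J → Bool} {p b₀ a} →
    w p b₀ ≡ true → Col b₀ → ¬ R a b₀ → InSpan w a → InSpan (eliminate w p b₀) a
  InSpan-eliminate {w = w} {p} {b₀} {a} wpb₀ col₀ ¬Rab₀ (c , span) = c ∘ punchIn p , λ b col →
    subst (λ x → (x ≡ true) ⇔ R a b) (sym (combination-eliminate c w p b₀ wpb₀ cwb₀≡false b)) (span b col)
    where
    cwb₀≡false : combination c w b₀ ≡ false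
    cwb₀≡false = ¬-not (¬Rab₀ ∘ Equivalence.to (span b₀ col₀))

  RowInSpan : ∀ {r} → (Fin r → J → Bool) → I × J → Set
  RowInSpan w = InSpan w ∘ proj₁

  OnDiagonal : I × J → Set
  OnDiagonal (a , b) = Col b × R a b

  VanishesBelow : I × J → I × J → Set
  VanishesBelow (_ , b) (a′ , _) = ¬ R a′ b

  triangular-length≤rank : ∀ {r} (w : Fin r → J → Bool) (ps : List (I × J)) →
    All OnDiagonal ps → AllPairs VanishesBelow ps → All (RowInSpan w) ps → length ps ≤ r
  triangular-length≤rank w [] _ _ _ = z≤n
  triangular-length≤rank {zero} w ((_ , b) ∷ _) ((col , Rab) ∷ _) _ ((c , span) ∷ _)
    with () ← Equivalence.from (span b col) Rab
  triangular-length≤rank {suc r} w ((a , b) ∷ ps) ((col , Rab) ∷ diag) (zeros ∷ tri) ((c , span) ∷ spans)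
    with p , cp∧wpb ← xorSum≡true⇒∃ (suc r) (λ l → c l ∧ w l b) (Equivalence.from (span b col) Rab) =
    s≤s (triangular-length≤rank (eliminate w p b) ps diag tri
          (All.zipWith (λ (¬Ra′b , span′) → InSpan-eliminate {w = w} {p} wpb col ¬Ra′b span′) (zeros , spans)))
    where
    wpb : w p b ≡ true
    wpb = ∧-conicalʳ (c p) (w p b) cp∧wpb

module _ {A : Set} where

  filter-map : ∀ {B : Set} {p} {P : Pred B p} (P? : Decidable P) (f : A → B) xs →
               filter P? (map f xs) ≡ map f (filter (P? ∘ f) xs)
  filter-map P? f []       = refl
  filter-map P? f (x ∷ xs) with does (P? (f x))
  ... | true  = cong (f x ∷_) (filter-map P? f xs)
  ... | false = filter-map P? f xs

  fibre : (A → Bool) → Bool → List A → List A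
  fibre f b = filter (λ x → f x ≟ b)

  length-fibres : ∀ (f : A → Bool) xs → length (fibre f true xs) + length (fibre f false xs) ≡ length xs
  length-fibres f []       = refl
  length-fibres f (x ∷ xs) with f x
  ... | true  = cong suc (length-fibres f xs)
  ... | false = trans (+-suc _ _) (cong suc (length-fibres f xs))

  length-fibre-true-∷ : ∀ (f : A → Bool) x xs →
    length (fibre f true (x ∷ xs)) ≡ (if f x then 1 else 0) + length (fibre f true xs)
  length-fibre-true-∷ f x xs with f x
  ... | true  = refl
  ... | false = refl

  All-reverse⁺ : ∀ {p} {P : Pred A p} {xs} → All P xs → All P (reverse xs)
  All-reverse⁺ pxs = All.tabulate (All.lookup pxs ∘ Anyₚ.reverse⁻)

  module _ {ℓ} {S : A → A → Set ℓ} where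

    AllPairs-reverse⁺ : ∀ {xs} → AllPairs S xs → AllPairs (flip S) (reverse xs)
    AllPairs-reverse⁺ []         = []
    AllPairs-reverse⁺ {x ∷ xs} (Sx ∷ Sxs) = subst (AllPairs (flip S)) (sym (unfold-reverse x xs))
      (AllPairsₚ.++⁺ (AllPairs-reverse⁺ Sxs) ([] ∷ []) (All.map (_∷ []) (All-reverse⁺ Sx)))

    AllPairs-strengthen : ∀ {p q} {P : Pred A p} {Q : A → A → Set q} →
      (∀ {x y} → P x → P y → Q x y → S x y) → ∀ {xs} → All P xs → AllPairs Q xs → AllPairs S xs
    AllPairs-strengthen f []         []         = []
    AllPairs-strengthen f (px ∷ pxs) (qx ∷ qxs) =
      All.zipWith (λ (py , q) → f px py q) (pxs , qx) ∷ AllPairs-strengthen f pxs qxs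

odd : ℕ → Bool
odd zero    = false
odd (suc n) = not (odd n)

Neighbours : ℕ → ℕ → Set
Neighbours u v = v ≡ suc u ⊎ u ≡ suc v

OddOnlyNeighbours : (ℕ → ℕ → Set) → Set
OddOnlyNeighbours S = ∀ {u v} → odd u ≡ true → S u v ⊎ S v u → Neighbours u v

OddOnlyNeighbours-flip : ∀ {S} → OddOnlyNeighbours S → OddOnlyNeighbours (flip S)
OddOnlyNeighbours-flip odd-only odd-u = odd-only odd-u ∘ ⊎-swap

<⇒¬Neighbours-suc : ∀ {t t′} → t < t′ → ¬ Neighbours (suc t′) t
<⇒¬Neighbours-suc t<t′ (inj₁ refl)         = <-asym t<t′ (m<n⇒m<1+n (n<1+n _))
<⇒¬Neighbours-suc t<t′ (inj₂ suc-t′≡suc-t) = <-irrefl (sym (suc-injective suc-t′≡suc-t)) t<t′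

same-parity-unrelated : ∀ {S} → OddOnlyNeighbours S →
  ∀ {t t′} → odd t ≡ odd t′ → t < t′ → ¬ S t (suc t′)
-- Exactly one of t and suc t′ is odd.
same-parity-unrelated odd-only {t} {t′} same t<t′ s with odd t in odd-t
... | true  = <⇒¬Neighbours-suc t<t′ (⊎-swap (odd-only odd-t (inj₁ s)))
... | false = <⇒¬Neighbours-suc t<t′ (odd-only (cong not (sym same)) (inj₂ s))

crossing : ∀ {m} → (Fin (suc m) → Bool) → Fin m → Bool
crossing side t = side (inject₁ t) xor side (fsuc t)

crossings : ∀ {m} → (Fin (suc m) → Bool) → List (Fin m)
crossings {m} side = fibre (crossing side) true (allFin m)

length-fibre-tabulate-suc : ∀ {m} (f : Fin (suc m) → Bool) b →
  length (fibre f b (tabulate fsuc)) ≡ length (fibre (f ∘ fsuc) b (allFin m))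
length-fibre-tabulate-suc {m} f b = begin
  length (fibre f b (tabulate fsuc))
    ≡⟨ cong (length ∘ fibre f b) (map-tabulate id fsuc) ⟨
  length (fibre f b (map fsuc (allFin m)))
    ≡⟨ cong length (filter-map (λ x → f x ≟ b) fsuc (allFin m)) ⟩
  length (map fsuc (fibre (f ∘ fsuc) b (allFin m)))
    ≡⟨ length-map fsuc (fibre (f ∘ fsuc) b (allFin m)) ⟩
  length (fibre (f ∘ fsuc) b (allFin m)) ∎
  where open ≡-Reasoning

numBlocks≡1+length-crossings : ∀ m (side : Fin (suc m) → Bool) →
  numBlocks (suc m) side ≡ suc (length (crossings side))
numBlocks≡1+length-crossings zero    side = refl
numBlocks≡1+length-crossings (suc m) side = begin
  c₀ + numBlocks (suc m) (side ∘ fsuc)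
    ≡⟨ cong (c₀ +_) (numBlocks≡1+length-crossings m (side ∘ fsuc)) ⟩
  c₀ + suc (length (crossings (side ∘ fsuc)))
    ≡⟨ +-suc c₀ _ ⟩
  suc (c₀ + length (crossings (side ∘ fsuc)))
    ≡⟨ cong (λ n → suc (c₀ + n)) (length-fibre-tabulate-suc (crossing side) true) ⟨
  suc (c₀ + length (fibre (crossing side) true (tabulate fsuc)))
    ≡⟨ cong suc (length-fibre-true-∷ (crossing side) fzero (tabulate fsuc)) ⟨
  suc (length (crossings side)) ∎
  where
  open ≡-Reasoning
  c₀ = if crossing side fzero then 1 else 0

module _ {m} (side : Fin (suc m) → Bool) where

  crossingsOfType : Bool → Bool → List (Fin m)
  crossingsOfType a o = fibre (odd ∘ toℕ) o (fibre (side ∘ inject₁) a (crossings side))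

  length-crossings : length (crossings side) ≡
    (length (crossingsOfType true true) + length (crossingsOfType true false)) +
    (length (crossingsOfType false true) + length (crossingsOfType false false))
  length-crossings = sym (trans
    (cong₂ _+_ (length-fibres (odd ∘ toℕ) (fibre (side ∘ inject₁) true (crossings side)))
               (length-fibres (odd ∘ toℕ) (fibre (side ∘ inject₁) false (crossings side))))
    (length-fibres (side ∘ inject₁) (crossings side)))

  CrossingOfType : Bool → Bool → Fin m → Set
  CrossingOfType a o t = side (inject₁ t) ≡ a × side (fsuc t) ≡ not a × odd (toℕ t) ≡ o

  all-crossingsOfType : ∀ a o → All (CrossingOfType a o) (crossingsOfType a o)
  all-crossingsOfType a o = All.zipWith member (All.zipWith id (crossing≡true , left≡a) , parity≡o)
    where
    crossing≡true = Allₚ.filter⁺ _ (Allₚ.filter⁺ _ (all-filter _ (allFin m)))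
    left≡a = Allₚ.filter⁺ _ (all-filter _ (crossings side))
    parity≡o = all-filter _ (fibre (side ∘ inject₁) a (crossings side))
    member : ∀ {t} → (crossing side t ≡ true × side (inject₁ t) ≡ a) × odd (toℕ t) ≡ o → CrossingOfType a o t
    member {t} ((crosses , left) , parity) =
      left , trans (xor≡true⇒≡not (side (inject₁ t)) _ crosses) (cong not left) , parity

  crossingsOfType-ascending : ∀ a o → AllPairs Data.Fin._<_ (crossingsOfType a o)
  crossingsOfType-ascending a o =
    AllPairsₚ.filter⁺ _ (AllPairsₚ.filter⁺ _ (AllPairsₚ.filter⁺ _ (tabulate⁺-< {f = id} id)))

module _ {m r} (R : ℕ → ℕ → Set) (odd-only : OddOnlyNeighbours R)
  (consecutive : ∀ (t : Fin m) → R (toℕ t) (suc (toℕ t)) × R (suc (toℕ t)) (toℕ t))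
  (side : Fin (suc m) → Bool) (w : Fin r → Fin (suc m) → Bool)
  (spans : ∀ a → side a ≡ true → InSpan (R on toℕ) (λ b → side b ≡ false) w a) where

  private
    Edge : Fin (suc m) → Fin (suc m) → Set
    Edge = R on toℕ
    Col : Fin (suc m) → Set
    Col b = side b ≡ false

    consecutive-edges : ∀ t → Edge (inject₁ t) (fsuc t) × Edge (fsuc t) (inject₁ t)
    consecutive-edges t rewrite toℕ-inject₁ t = consecutive t

  crossingsOfType-length≤rank : ∀ a o → length (crossingsOfType side a o) ≤ r
  -- Here the row of a crossing can meet the column of the crossing two places to its left,
  -- so the pivots are listed from right to left.
  crossingsOfType-length≤rank true o =
    subst (_≤ r) (trans (length-reverse (map pivot cs)) (length-map pivot cs))
      (triangular-length≤rank Edge Col w (reverse (map pivot cs))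
        (All-reverse⁺ diagonal) (AllPairs-reverse⁺ triangular) (All-reverse⁺ spanned))
    where
    cs = crossingsOfType side true o
    members = all-crossingsOfType side true o
    pivot : Fin m → Fin (suc m) × Fin (suc m)
    pivot t = inject₁ t , fsuc t
    unrelated : ∀ {t t′} → CrossingOfType side true o t → CrossingOfType side true o t′ →
                t Data.Fin.< t′ → ¬ Edge (inject₁ t) (fsuc t′)
    unrelated {t} (_ , _ , parity) (_ , _ , parity′) t<t′ rewrite toℕ-inject₁ t =
      same-parity-unrelated odd-only (trans parity (sym parity′)) t<t′
    diagonal : All (OnDiagonal Edge Col) (map pivot cs)
    diagonal = Allₚ.map⁺ (All.map (λ {t} (_ , col , _) → col , proj₁ (consecutive-edges t)) members)
    triangular : AllPairs (flip (VanishesBelow Edge Col)) (map pivot cs)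
    triangular = AllPairsₚ.map⁺ (AllPairs-strengthen unrelated members (crossingsOfType-ascending side true o))
    spanned : All (RowInSpan Edge Col w) (map pivot cs)
    spanned = Allₚ.map⁺ (All.map (λ {t} (row , _) → spans (inject₁ t) row) members)
  crossingsOfType-length≤rank false o =
    subst (_≤ r) (length-map pivot cs)
      (triangular-length≤rank Edge Col w (map pivot cs) diagonal triangular spanned)
    where
    cs = crossingsOfType side false o
    members = all-crossingsOfType side false o
    pivot : Fin m → Fin (suc m) × Fin (suc m)
    pivot t = fsuc t , inject₁ t
    unrelated : ∀ {t t′} → CrossingOfType side false o t → CrossingOfType side false o t′ →
                t Data.Fin.< t′ → ¬ Edge (fsuc t′) (inject₁ t)
    unrelated {t} (_ , _ , parity) (_ , _ , parity′) t<t′ rewrite toℕ-inject₁ t =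
      same-parity-unrelated (OddOnlyNeighbours-flip odd-only) (trans parity (sym parity′)) t<t′
    diagonal : All (OnDiagonal Edge Col) (map pivot cs)
    diagonal = Allₚ.map⁺ (All.map (λ {t} (col , _) → col , proj₂ (consecutive-edges t)) members)
    triangular : AllPairs (VanishesBelow Edge Col) (map pivot cs)
    triangular = AllPairsₚ.map⁺ (AllPairs-strengthen unrelated members (crossingsOfType-ascending side false o))
    spanned : All (RowInSpan Edge Col w) (map pivot cs)
    spanned = Allₚ.map⁺ (All.map (λ {t} (_ , row , _) → spans (fsuc t) row) members)

  numBlocks-suc≤4*rank+1 : numBlocks (suc m) side ≤ 4 * r + 1
  numBlocks-suc≤4*rank+1 = begin
    numBlocks (suc m) side
      ≡⟨ numBlocks≡1+length-crossings m side ⟩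
    suc (length (crossings side))
      ≡⟨ cong suc (length-crossings side) ⟩
    suc ((count true true + count true false) + (count false true + count false false))
      ≤⟨ s≤s (+-mono-≤ (+-mono-≤ (bound true true) (bound true false))
                       (+-mono-≤ (bound false true) (bound false false))) ⟩
    suc ((r + r) + (r + r))
      ≡⟨ solve 1 (λ r → con 1 :+ ((r :+ r) :+ (r :+ r)) := con 4 :* r :+ con 1) refl r ⟩
    4 * r + 1 ∎
    where
    open ≤-Reasoning
    open +-*-Solver
    count = λ a o → length (crossingsOfType side a o)
    bound = crossingsOfType-length≤rank

numBlocks≤4*rank+1 : ∀ {n r} (R : ℕ → ℕ → Set) → OddOnlyNeighbours R →
  (∀ t → suc t < n → R t (suc t) × R (suc t) t) →
  (side : Fin n → Bool) (w : Fin r → Fin n → Bool) →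
  (∀ a → side a ≡ true → InSpan (R on toℕ) (λ b → side b ≡ false) w a) →
  numBlocks n side ≤ 4 * r + 1
numBlocks≤4*rank+1 {zero}  _ _ _ _ _ _ = z≤n
numBlocks≤4*rank+1 {suc m} R odd-only consecutive side w spans =
  numBlocks-suc≤4*rank+1 R odd-only (λ t → consecutive (toℕ t) (s≤s (toℕ<n t))) side w spans

odd-double : ∀ j → odd (2 * j) ≡ false
odd-double zero    = refl
odd-double (suc j) rewrite +-suc j (j + 0) | odd-double j = refl

P≢odd-vertex : ∀ i j {u} → odd u ≡ true → P i j ≢ vtx u
P≢odd-vertex zero    j odd-u refl with () ← trans (sym (odd-double j)) odd-u
P≢odd-vertex (suc i) j odd-u ()

IsNeighbourVertex : ℕ → Node → Set
IsNeighbourVertex u nd = ∃ λ v → nd ≡ vtx v × Neighbours u v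

track-from-odd : ∀ {k u x y} → DTrack k x y → proj₁ x ≡ vtx u → odd u ≡ true → IsNeighbourVertex u (proj₁ y)
track-from-odd (inj₁ (line _))               refl _     = _ , refl , inj₁ refl
track-from-odd (inj₁ (semi {i} {j} _ _ _))   at-u odd-u = ⊥-elim (P≢odd-vertex i j odd-u at-u)
track-from-odd (inj₁ (arcL {i} {j} _))       at-u odd-u = ⊥-elim (P≢odd-vertex i j odd-u at-u)
track-from-odd (inj₁ (arcM _))               ()   _
track-from-odd (inj₁ (arcR _))               ()   _
track-from-odd (inj₁ (upL _))                ()   _
track-from-odd (inj₁ (upR _))                ()   _
track-from-odd (inj₂ (line _))               refl _     = _ , refl , inj₂ refl
track-from-odd (inj₂ (semi {i} {j} _ _ _))   at-u odd-u = ⊥-elim (P≢odd-vertex i (suc j) odd-u at-u)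
track-from-odd (inj₂ (arcL _))               ()   _
track-from-odd (inj₂ (arcM _))               ()   _
track-from-odd (inj₂ (arcR {i} {j} _))       at-u odd-u = ⊥-elim (P≢odd-vertex i (suc j) odd-u at-u)
track-from-odd (inj₂ (upL _))                ()   _
track-from-odd (inj₂ (upR _))                ()   _

walk-from-odd : ∀ {k u e} → SmoothWalk k u e → odd u ≡ true → IsNeighbourVertex u (proj₁ e)
walk-from-odd (start track) odd-u = track-from-odd track refl odd-u
walk-from-odd (step walk junction _ _) odd-u with walk-from-odd walk odd-u
... | _ , refl , _ = ⊥-elim junction

walk-to-odd : ∀ {k u v s} → SmoothWalk k u (vtx v , s) → odd v ≡ true → Neighbours v u
walk-to-odd (start track) odd-v with track-from-odd (⊎-swap track) refl odd-v
... | _ , refl , neighbours = neighbours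
walk-to-odd (step _ junction _ track) odd-v with track-from-odd (⊎-swap track) refl odd-v
... | _ , refl , _ = ⊥-elim junction

Adj-oddOnlyNeighbours : ∀ k → OddOnlyNeighbours (Adj k)
Adj-oddOnlyNeighbours k odd-u (inj₁ (_ , _ , walk)) with walk-from-odd walk odd-u
... | _ , refl , neighbours = neighbours
Adj-oddOnlyNeighbours k odd-u (inj₂ (_ , _ , walk)) = walk-to-odd walk odd-u

Adj-consecutive : ∀ k t → suc t < 3 ^ k → Adj k t (suc t) × Adj k (suc t) t
Adj-consecutive k t t+1<n =
  (1+n≢n ∘ sym , s₀ , start (inj₁ (line t+1<n))) , (1+n≢n , s₀ , start (inj₂ (line t+1<n)))

-- The bound holds for k = 0 as well.
lemma12 : (k r : ℕ) → 1 ≤ k → (side : Fin (3 ^ k) → Bool) →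
    BiadjRankAtMost k side r → numBlocks (3 ^ k) side ≤ 4 * r + 1
lemma12 k r _ side (w , spans) =
  numBlocks≤4*rank+1 (Adj k) (Adj-oddOnlyNeighbours k) (Adj-consecutive k) side w spans
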